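{- (Löb induction.) In the internal logic of $\mathcal{S}$: $\forall\,\kappa:\mathbb{K}.\ \forall\,\phi:\Omega.\ (\triangleright^{\kappa}\phi\Rightarrow\phi)\Rightarrow\phi$.
   Context: Let $\mathbb{F}^+$ be the category whose objects are $\bullet^n$ for $n>0$ (free category with strictly associative binary products on one object); a morphism $\bullet^n\to\bullet^m$ is equivalently a function $\{0,\dots,m-1\}\to\{0,\dots,n-1\}$. Let $\mathcal{N}=\mathrm{Hom}_{\mathbb{F}^+}(-,\bullet^1)$. For $U\in\mathbb{F}^+$ let $\mathrm{CLK}[U]=\omega^{\mathcal{N}(U)}$ ordered pointwise, with $\mathrm{CLK}[f](\partial_V)=(\kappa\mapsto\partial_V(f^*\kappa))$ for $f:V\to U$. The category $\mathbb{CLK}$ has objects $\mathbf{U}=(U,\partial_U)$ and morphisms $f:(V,\partial_V)\to(U,\partial_U)$ the $\mathbb{F}^+$-maps $f:V\to U$ with $\mathrm{CLK}[f](\partial_V)\le\partial_U$. $\mathcal{S}$ is the presheaf topos on $\mathbb{CLK}$, with clock object $\mathbb{K}(U,\partial_U)=\mathcal{N}(U)$ and subobject classifier $\Omega$. Write $\mathbf{U}[\kappa\mapsto n]$ for $(U,\partial_U[\kappa\mapsto n])$ and $[\kappa\mathrel{+}=1]:\mathbf{U}\to\mathbf{U}[\kappa\mapsto\partial_U(\kappa)+1]$ for the morphism with identity underlying map. The later modality is defined by forcing: $\mathbf{U}\Vdash\triangleright^{\kappa}\phi(\alpha)$ iff $\partial_U(\kappa)=0$, or $\partial_U(\kappa)=n+1$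 and $\mathbf{U}[\kappa\mapsto n]\Vdash\phi([\kappa\mathrel{+}=1]^*\alpha)$. Other connectives are interpreted by standard Kripke–Joyal semantics. -}

module Defs where

open import Level using (Lift; lift; lower) renaming (suc to lsuc; zero to lzero)
open import Data.Nat using (ℕ; zero; suc; _≤_)
open import Data.Nat.Properties using (≤-refl; n≤1+n)
open import Data.Fin using (Fin; _≟_)
open import Data.Unit using (⊤; tt)
open import Data.Product using (Σ; _,_; proj₁; proj₂)
open import Data.Sum using (_⊎_)
open import Relation.Nullary using (yes; no)
open import Relation.Binary.PropositionalEquality using (_≡_; refl; sym; subst)

-- The category CLK.
-- An object of F⁺ is •ⁿ with n > 0; we write n = suc ar.
-- 𝒩(•ⁿ) = Hom(•ⁿ, •¹) ≅ Fin n.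
-- An object of CLK is (U, ∂_U) with ∂_U ∈ ω^{𝒩(U)} = Fin n → ℕ.

record Obj : Set where
  constructor obj
  field
    ar  : ℕ
    clk : Fin (suc ar) → ℕ
open Obj public

Clock : Obj → Set
Clock U = Fin (suc (ar U))

-- A morphism f : (V,∂_V) → (U,∂_U): an F⁺-map •ⁿ → •ᵐ, i.e. a function
-- Fin m → Fin n, with CLK[f](∂_V) ≤ ∂_U pointwise, where
-- CLK[f](∂_V)(κ) = ∂_V(f*κ) and f*κ = fun f κ.
record Hom (V U : Obj) : Set where
  constructor hom
  field
    fun   : Clock U → Clock V
    .mono : ∀ κ → clk V (fun κ) ≤ clk U κ
open Hom public

idH : ∀ {U} → Hom U U
idH = hom (λ κ → κ) (λ κ → ≤-refl)

_∘H_ : ∀ {U V W} → Hom V U → Hom W V → Hom W U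
hom f mf ∘H hom g mg =
  hom (λ κ → g (f κ))
      (λ κ → Data.Nat.Properties.≤-trans (mg (f κ)) (mf κ))

upd : ∀ {m} → (Fin m → ℕ) → Fin m → ℕ → Fin m → ℕ
upd ∂ κ n i with i ≟ κ
... | yes _ = n
... | no  _ = ∂ i

_[_↦_] : (U : Obj) → Clock U → ℕ → Obj
U [ κ ↦ n ] = obj (ar U) (upd (clk U) κ n)

-- If ∂_U(κ) = n+1 then [κ += 1] : U[κ ↦ n] → U[κ ↦ n][κ ↦ n+1] = U
-- (identity underlying map).
plus1-mono : ∀ (U : Obj) κ n → clk U κ ≡ suc n →
             ∀ i → upd (clk U) κ n i ≤ clk U i
plus1-mono U κ n e i with i ≟ κ
... | yes refl = subst (n ≤_) (sym e) (n≤1+n n)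
... | no  _    = ≤-refl

plus1 : ∀ (U : Obj) κ n → clk U κ ≡ suc n → Hom (U [ κ ↦ n ]) U
plus1 U κ n e = hom (λ i → i) (plus1-mono U κ n e)

-- Presheaves on CLK (only the data needed for Kripke–Joyal forcing).

record Psh : Set₂ where
  field
    Ob : Obj → Set₁
    re : ∀ {U V} → Hom V U → Ob U → Ob V
open Psh public

𝟙 : Psh
𝟙 = record { Ob = λ _ → Lift (lsuc lzero) ⊤ ; re = λ _ x → x }

𝕂 : Psh
𝕂 = record { Ob = λ U → Lift (lsuc lzero) (Clock U) ; re = λ f κ → lift (fun f (lower κ)) }

record Sieve (U : Obj) : Set₁ where
  field
    mem    : ∀ {V} → Hom V U → Set
    closed : ∀ {V W} (f : Hom V U) (g : Hom W V) → mem f → mem (f ∘H g)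
open Sieve public

pullS : ∀ {U V} → Hom V U → Sieve U → Sieve V
pullS f S = record
  { mem    = λ g → mem S (f ∘H g)
  ; closed = λ g h m → closed S (f ∘H g) h m }

ΩP : Psh
ΩP = record { Ob = Sieve ; re = pullS }

_▹_ : Psh → Psh → Psh
Γ ▹ A = record
  { Ob = λ U → Σ (Ob Γ U) (λ _ → Ob A U)
  ; re = λ f p → re Γ f (proj₁ p) , re A f (proj₂ p) }

-- Kripke–Joyal forcing.  A formula in context Γ is a forcing relation
-- U ⊩ φ(α) for α ∈ Γ(U).

Form : Psh → Set₂
Form Γ = (U : Obj) → Ob Γ U → Set₁

Tm : Psh → Psh → Set₁
Tm Γ A = (U : Obj) → Ob Γ U → Ob A U

atom : ∀ {Γ} → Tm Γ ΩP → Form Γ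
atom t U α = Lift (lsuc lzero) (mem (t U α) idH)

_⇒_ : ∀ {Γ} → Form Γ → Form Γ → Form Γ
_⇒_ {Γ} φ ψ U α = ∀ {V} (f : Hom V U) → φ V (re Γ f α) → ψ V (re Γ f α)

Π : ∀ {Γ} (A : Psh) → Form (Γ ▹ A) → Form Γ
Π {Γ} A φ U α = ∀ {V} (f : Hom V U) (a : Ob A V) → φ V (re Γ f α , a)

▷ : ∀ {Γ} → Tm Γ 𝕂 → Form Γ → Form Γ
▷ {Γ} k φ U α =
  Lift (lsuc lzero) (clk U (lower (k U α)) ≡ 0)
  ⊎ Σ ℕ (λ n → Σ (clk U (lower (k U α)) ≡ suc n) (λ e →
      φ (U [ lower (k U α) ↦ n ]) (re Γ (plus1 U (lower (k U α)) n e) α)))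

-- a closed formula holds in S iff it is forced at every stage
Valid : Form 𝟙 → Set₁
Valid φ = ∀ (U : Obj) → φ U (lift tt)

private
  Ctx : Psh
  Ctx = (𝟙 ▹ 𝕂) ▹ ΩP

  vκ : Tm Ctx 𝕂
  vκ U α = proj₂ (proj₁ α)

  vφ : Tm Ctx ΩP
  vφ U α = proj₂ α

LöbFormula : Form 𝟙
LöbFormula =
  Π {𝟙} 𝕂 (Π {𝟙 ▹ 𝕂} ΩP
    (_⇒_ {Ctx} (_⇒_ {Ctx} (▷ {Ctx} vκ (atom {Ctx} vφ)) (atom {Ctx} vφ))
               (atom {Ctx} vφ)))

module Submission where

-- The argument is well-founded induction on the value ∂_X(κ) of the clock at
-- the current stage X.  Given the hypothesis  ▷^κ φ ⇒ φ  at X, it suffices to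
-- force ▷^κ φ at X.  If ∂_X(κ) = 0 this is immediate.  If ∂_X(κ) = n+1 we must
-- force φ at the earlier stage X[κ ↦ n]; there the clock has value n, and the
-- hypothesis, being an implication, restricts along [κ += 1] to X[κ ↦ n]
-- (Kripke monotonicity), so the induction hypothesis applies.

open import Defs
open import Level using (lift; lower)
open import Data.Nat using (ℕ; zero; suc)
open import Data.Fin using (Fin; _≟_)
open import Data.Empty using (⊥-elim)
open import Data.Product using (_,_; proj₁; proj₂)
open import Data.Sum using (inj₁; inj₂)
open import Relation.Nullary using (yes; no)
open import Relation.Binary.PropositionalEquality using (_≡_; refl)

upd-same : ∀ {m} (∂ : Fin m → ℕ) (κ : Fin m) (n : ℕ) → upd ∂ κ n κ ≡ n
upd-same ∂ κ n with κ ≟ κ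
... | yes _  = refl
... | no κ≢κ = ⊥-elim (κ≢κ refl)

LöbCtx : Psh
LöbCtx = (𝟙 ▹ 𝕂) ▹ ΩP

clockVar : Tm LöbCtx 𝕂
clockVar U α = proj₂ (proj₁ α)

propVar : Tm LöbCtx ΩP
propVar U α = proj₂ α

clockAt : (X : Obj) → Ob LöbCtx X → Clock X
clockAt X α = lower (clockVar X α)

LöbHyp : Form LöbCtx → Form LöbCtx
LöbHyp φ = _⇒_ {LöbCtx} (▷ {LöbCtx} clockVar φ) φ

-- Kripke monotonicity of implication: a forced implication stays forced after
-- restriction along any morphism (restriction in LöbCtx is strictly functorial).
⇒-restrict : (φ ψ : Form LöbCtx) {X Y : Obj} {α : Ob LöbCtx X} (f : Hom Y X) →
             _⇒_ {LöbCtx} φ ψ X α → _⇒_ {LöbCtx} φ ψ Y (re LöbCtx f α)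
⇒-restrict φ ψ f H g = H (f ∘H g)

löb-at : (φ : Form LöbCtx) (n : ℕ) (X : Obj) (α : Ob LöbCtx X) →
         clk X (clockAt X α) ≡ n → LöbHyp φ X α → φ X α
löb-at φ zero X α κ≡0 H = H idH (inj₁ (lift κ≡0))
löb-at φ (suc n) X α κ≡1+n H =
  H idH (inj₂ (n , κ≡1+n , löb-at φ n X′ α′ (upd-same (clk X) κ n) H′))
  where
    κ : Clock X
    κ = clockAt X α
    X′ : Obj
    X′ = X [ κ ↦ n ]
    tick : Hom X′ X
    tick = plus1 X κ n κ≡1+n
    α′ : Ob LöbCtx X′
    α′ = re LöbCtx tick α
    H′ : LöbHyp φ X′ α′
    H′ = ⇒-restrict (▷ {LöbCtx} clockVar φ) φ {α = α} tick H

löb : (φ : Form LöbCtx) (X : Obj) (α : Ob LöbCtx X) → LöbHyp φ X α → φ X α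
löb φ X α = löb-at φ (clk X (clockAt X α)) X α refl

-- Unfolding the two quantifiers and the outer implication leaves a stage with
-- the environment (κ, φ) restricted to it; apply Löb induction to the atom φ.
mainTheorem8 : Valid LöbFormula
mainTheorem8 U f κ g S h =
  löb (atom {LöbCtx} propVar) _ (re LöbCtx h (re (𝟙 ▹ 𝕂) g (lift _ , κ) , S))
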